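{- Let $q=2$ and let $\mathcal W(5,2)$ be the symplectic polar space of ${\rm PG}(5,2)$ defined by the alternating form with Gram matrix $\begin{pmatrix}0_3 & I_3\\ -I_3 & 0_3\end{pmatrix}$, with polarity $\perp$. Let $\Pi_1=\langle U_4,U_5,U_6\rangle$, $\Pi_2=\langle U_1,U_2,U_3\rangle$. For each point $P\in\Pi_2$ choose a $3$-space $\Sigma_P\subseteq P^\perp$ with $P\notin \Sigma_P$, let $\mathcal W_P$ be the induced symplectic polar space on $\Sigma_P$, $r_P=\Sigma_P\cap\Pi_1$, $t_P=\Sigma_P\cap\Pi_2$, choose a line-spread $\mathcal F_P$ of $\mathcal W_P$ containing $r_P,t_P$, and let $\mathcal X_P=\{\langle P,\ell\rangle:\ell\in\mathcal F_P\setminus\{r_P,t_P\}\}$; put $\mathcal X=\bigcup_{P\in\Pi_2}\mathcal X_P\cup\{\Pi_2\}$. For a $3\times 3$ symmetric matrix $S$ over ${\rm GF}(2)$ let $L(S)$ be the plane spanned by the rows of $\begin{pmatrix}I_3 & S\end{pmatrix}$. Then the set $\mathcal C=\{S\in\mathcal S_{3,2}: L(S)\in\mathcal X\}$ is a $2$-code of $\mathcal S_{3,2}$ that is maximal, i.e. there is no $S'\in\mathcal S_{3,2}\setminus\mathcal C$ with ${\rm rk}(S'-S)\ge2$ for all $S\in\mathcal C$.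
   Context: $U_i$ is the point with $1$ in position $i$ and $0$ elsewhere. $\mathcal S_{3,2}$ is the set of $3\times 3$ symmetric matrices over ${\rm GF}(2)$; a $2$-code is a subset with pairwise rank distance ${\rm rk}(A-B)\ge 2$. A line-spread of $\mathcal W_P$ is a set of pairwise disjoint totally isotropic lines partitioning the points of $\Sigma_P$. The map $S\mapsto L(S)$ is a bijection between $\mathcal S_{3,2}$ and the planes of $\mathcal W(5,2)$ disjoint from $\Pi_1$. -}

module Defs where

open import Data.Bool using (Bool; true; false; _∧_; _∨_; _xor_; not)
open import Data.Nat using (ℕ; zero; suc)
open import Data.Nat.Logarithm using (⌊log₂_⌋)
open import Data.Fin using (Fin)
open import Data.Vec as Vec using (Vec; []; _∷_; zipWith; replicate; lookup; _++_)
open import Data.List as List using (List)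
open import Data.List.Relation.Unary.Any using (Any)
open import Data.List.Relation.Unary.All using (All)
open import Data.List.Relation.Unary.AllPairs using (AllPairs)
open import Data.Product using (Σ-syntax; _×_)
open import Data.Sum using (_⊎_)
open import Relation.Binary.PropositionalEquality using (_≡_)
open import Relation.Nullary using (¬_)

_⊕_ : ∀ {n} → Vec Bool n → Vec Bool n → Vec Bool n
_⊕_ = zipWith _xor_

0v : ∀ {n} → Vec Bool n
0v = replicate _ false

isZero : ∀ {n} → Vec Bool n → Bool
isZero [] = true
isZero (x ∷ xs) = not x ∧ isZero xs

dot : ∀ {n} → Vec Bool n → Vec Bool n → Bool
dot [] [] = false
dot (x ∷ xs) (y ∷ ys) = (x ∧ y) xor dot xs ys

matVec : ∀ {m n} → Vec (Vec Bool n) m → Vec Bool n → Vec Bool m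
matVec M v = Vec.map (λ row → dot row v) M

allVecs : (n : ℕ) → List (Vec Bool n)
allVecs zero = [] List.∷ List.[]
allVecs (suc n) = List.map (false ∷_) (allVecs n) List.++ List.map (true ∷_) (allVecs n)

VSet : ℕ → Set
VSet n = Vec Bool n → Bool

card : ∀ {n} → VSet n → ℕ
card {n} A = List.length (List.filterᵇ A (allVecs n))

span : ∀ {n} → List (Vec Bool n) → VSet n
span List.[] v = isZero v
span (r List.∷ rs) v = span rs v ∨ span rs (v ⊕ r)

IsSubspace : ∀ {n} → VSet n → Set
IsSubspace A = A 0v ≡ true × (∀ u v → A u ≡ true → A v ≡ true → A (u ⊕ v) ≡ true)

_⊆_ : ∀ {n} → VSet n → VSet n → Set
A ⊆ B = ∀ v → A v ≡ true → B v ≡ true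

_≐_ : ∀ {n} → VSet n → VSet n → Set
A ≐ B = ∀ v → A v ≡ B v

_∩_ : ∀ {n} → VSet n → VSet n → VSet n
(A ∩ B) v = A v ∧ B v

-- PG(5,2): points are nonzero vectors of GF(2)^6
V6 : Set
V6 = Vec Bool 6

IsPoint : V6 → Set
IsPoint P = isZero P ≡ false

U₁ U₂ U₃ U₄ U₅ U₆ : V6
U₁ = true ∷ false ∷ false ∷ false ∷ false ∷ false ∷ []
U₂ = false ∷ true ∷ false ∷ false ∷ false ∷ false ∷ []
U₃ = false ∷ false ∷ true ∷ false ∷ false ∷ false ∷ []
U₄ = false ∷ false ∷ false ∷ true ∷ false ∷ false ∷ []
U₅ = false ∷ false ∷ false ∷ false ∷ true ∷ false ∷ []
U₆ = false ∷ false ∷ false ∷ false ∷ false ∷ true ∷ []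

-- Gram matrix [[0,I],[-I,0]]; over GF(2), -I = I
gram : Vec V6 6
gram = U₄ ∷ U₅ ∷ U₆ ∷ U₁ ∷ U₂ ∷ U₃ ∷ []

form : V6 → V6 → Bool
form u v = dot u (matVec gram v)

perp : V6 → VSet 6
perp P v = not (form P v)

Π₁ Π₂ : VSet 6
Π₁ = span (U₄ List.∷ U₅ List.∷ U₆ List.∷ List.[])
Π₂ = span (U₁ List.∷ U₂ List.∷ U₃ List.∷ List.[])

-- a totally isotropic line of W(5,2) contained in Σ (i.e. a line of the induced space on Σ)
IsTILineIn : VSet 6 → VSet 6 → Set
IsTILineIn Sg ℓ = IsSubspace ℓ × card ℓ ≡ 4 × ℓ ⊆ Sg
                  × (∀ u v → ℓ u ≡ true → ℓ v ≡ true → form u v ≡ false)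

Disjoint : VSet 6 → VSet 6 → Set
Disjoint ℓ m = ∀ v → ℓ v ≡ true → m v ≡ true → v ≡ 0v

IsLineSpread : VSet 6 → List (VSet 6) → Set
IsLineSpread Sg F = All (IsTILineIn Sg) F × AllPairs Disjoint F
                    × (∀ v → Sg v ≡ true → IsPoint v → Any (λ ℓ → ℓ v ≡ true) F)

join : V6 → VSet 6 → VSet 6
join P ℓ v = ℓ v ∨ ℓ (v ⊕ P)

record Choice : Set where
  field
    Sig : V6 → VSet 6
    F   : V6 → List (VSet 6)
    Sig-ok : ∀ P → IsPoint P → Π₂ P ≡ true →
             IsSubspace (Sig P) × card (Sig P) ≡ 16 × Sig P ⊆ perp P × Sig P P ≡ false
    F-ok : ∀ P → IsPoint P → Π₂ P ≡ true →
           IsLineSpread (Sig P) (F P)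
           × Any (λ ℓ → ℓ ≐ (Sig P ∩ Π₁)) (F P)
           × Any (λ ℓ → ℓ ≐ (Sig P ∩ Π₂)) (F P)

open Choice public

InX : Choice → VSet 6 → Set
InX c π = π ≐ Π₂
  ⊎ Σ[ P ∈ V6 ] (IsPoint P × Π₂ P ≡ true ×
       Any (λ ℓ → ¬ (ℓ ≐ (Sig c P ∩ Π₁)) × ¬ (ℓ ≐ (Sig c P ∩ Π₂)) × π ≐ join P ℓ) (F c P))

Mat3 : Set
Mat3 = Vec (Vec Bool 3) 3

IsSym : Mat3 → Set
IsSym S = ∀ i j → lookup (lookup S i) j ≡ lookup (lookup S j) i

-- A - B = A + B over GF(2)
_⊟_ : Mat3 → Mat3 → Mat3
A ⊟ B = zipWith _⊕_ A B

-- rank = dimension of the row space; a GF(2)-space of dimension d has 2^d elements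
rk : Mat3 → ℕ
rk M = ⌊log₂ card (span (Vec.toList M)) ⌋

I₃ : Mat3
I₃ = (true ∷ false ∷ false ∷ []) ∷ (false ∷ true ∷ false ∷ []) ∷ (false ∷ false ∷ true ∷ []) ∷ []

L : Mat3 → VSet 6
L S = span (Vec.toList (zipWith _++_ I₃ S))

InC : Choice → Mat3 → Set
InC c S = IsSym S × InX c (L S)

module Submission where

-- Whatever Σ_P and 𝓕_P are chosen, the code consists of 0 and the 21 symmetric matrices of rank 2
-- with a nonzero diagonal; that this explicit set is a maximal 2-code is then a finite check.
--
-- For P ∈ Π₂ and ℓ ∈ 𝓕_P ∖ {r_P, t_P}, the plane ⟨P, ℓ⟩ is totally isotropic and meets Π₁ in 0 and
-- Π₂ in ⟨P⟩, so it is L(S) for a symmetric S of rank 2 with kernel P. There are four such S: three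
-- with nonzero diagonal and the alternating A_P. As Σ_P is a hyperplane of P^⊥ missing P, every
-- u ∈ P^⊥ has u or u + P in Σ_P, so each point of P^⊥ off Π₁ ∪ Π₂ lies, up to P, on a line of 𝓕_P.
-- The spread line through a point outside L(A_P) spans a plane meeting L(A_P) outside ⟨P⟩, so no
-- line of 𝓕_P spans L(A_P); and each of the other three planes is ⟨P, ℓ⟩ for the spread line ℓ
-- through one of its points outside L(A_P).

open import Defs
open import Data.Bool using (Bool; true; false; _∧_; _∨_; _xor_; not; if_then_else_; T)
open import Data.Bool.Properties using (T-≡; ∧-zeroʳ; ∨-comm; xor-assoc; xor-comm; xor-same; xor-identityʳ)
open import Data.Empty using (⊥; ⊥-elim)
open import Data.Bool.ListAction using (all; any)
open import Data.List as List using (List; []; _∷_; _++_)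
open import Data.List.Membership.Propositional using (_∈_)
open import Data.List.Membership.Propositional.Properties using (∈-map⁺; ∈-++⁺ˡ; ∈-++⁺ʳ)
open import Data.List.Relation.Unary.All as All using (All; []; _∷_)
open import Data.List.Relation.Unary.All.Properties using (all⁺; all⁻)
open import Data.List.Relation.Unary.Any as Any using (Any; here; there)
open import Data.List.Relation.Unary.Any.Properties using (any⁺; any⁻)
open import Data.List.Relation.Unary.AllPairs using (AllPairs; []; _∷_)
open import Data.Nat using (ℕ; zero; suc; _+_; _≤_; _≤ᵇ_; _≡ᵇ_; z≤n; s≤s)
open import Data.Nat.Properties
  using (module ≤-Reasoning; +-comm; +-assoc; +-suc; +-identityʳ; +-cancelˡ-≡; m≤n⇒m≤1+n; ≤ᵇ⇒≤; ≤⇒≤ᵇ; ≡ᵇ⇒≡)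
open import Data.Product using (∃; ∃₂; ∃-syntax; _×_; _,_; proj₁; proj₂)
open import Data.Sum using (_⊎_; inj₁; inj₂)
import Data.Fin as Fin
open import Data.Vec as Vec using (Vec; []; _∷_)
open import Data.Vec.Properties using (zipWith-assoc; zipWith-identityˡ; zipWith-identityʳ)
open import Function using (_∘_; Equivalence)
open import Relation.Binary.PropositionalEquality
  using (_≡_; _≢_; refl; sym; trans; cong; cong₂; subst; subst₂; module ≡-Reasoning)
open import Relation.Nullary using (¬_)

private variable
  n : ℕ

infixr 1 _⇒ᵇ_
_⇒ᵇ_ : Bool → Bool → Bool
a ⇒ᵇ b = not a ∨ b

mp : ∀ {a b} → (a ⇒ᵇ b) ≡ true → a ≡ true → b ≡ true
mp h refl = h

∧-intro : ∀ {a b} → a ≡ true → b ≡ true → a ∧ b ≡ true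
∧-intro refl h = h

∧-elim : ∀ {a b} → a ∧ b ≡ true → a ≡ true × b ≡ true
∧-elim {true} h = refl , h

∨-elim : ∀ {a b} → a ∨ b ≡ true → a ≡ true ⊎ b ≡ true
∨-elim {true} _ = inj₁ refl
∨-elim {false} h = inj₂ h

∨-introˡ : ∀ {a b} → a ≡ true → a ∨ b ≡ true
∨-introˡ refl = refl

∨-introʳ : ∀ {a b} → b ≡ true → a ∨ b ≡ true
∨-introʳ {true} _ = refl
∨-introʳ {false} h = h

not-true : ∀ {a} → not a ≡ true → a ≡ false
not-true {false} _ = refl

not-false : ∀ {a} → a ≡ false → not a ≡ true
not-false refl = refl

true≢false : ∀ {a} → a ≡ true → a ≡ false → ⊥
true≢false refl ()

∨-elim-false : ∀ {a b} → a ≡ false → a ∨ b ≡ true → b ≡ true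
∨-elim-false refl h = h

T⇒≡ : ∀ {a} → T a → a ≡ true
T⇒≡ = Equivalence.to T-≡

≡⇒T : ∀ {a} → a ≡ true → T a
≡⇒T = Equivalence.from T-≡

xnor-sound : ∀ {a b} → not (a xor b) ≡ true → a ≡ b
xnor-sound {true} {true} _ = refl
xnor-sound {false} {false} _ = refl

⊕-assoc : (u v w : Vec Bool n) → (u ⊕ v) ⊕ w ≡ u ⊕ (v ⊕ w)
⊕-assoc = zipWith-assoc xor-assoc

⊕-comm : (u v : Vec Bool n) → u ⊕ v ≡ v ⊕ u
⊕-comm [] [] = refl
⊕-comm (a ∷ u) (b ∷ v) = cong₂ _∷_ (xor-comm a b) (⊕-comm u v)

⊕-self : (v : Vec Bool n) → v ⊕ v ≡ 0v
⊕-self [] = refl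
⊕-self (a ∷ v) = cong₂ _∷_ (xor-same a) (⊕-self v)

⊕-identityʳ : (v : Vec Bool n) → v ⊕ 0v ≡ v
⊕-identityʳ = zipWith-identityʳ xor-identityʳ

⊕-identityˡ : (v : Vec Bool n) → 0v ⊕ v ≡ v
⊕-identityˡ = zipWith-identityˡ (λ _ → refl)

⊕-cancelʳ : (u v : Vec Bool n) → (u ⊕ v) ⊕ v ≡ u
⊕-cancelʳ u v = begin
  (u ⊕ v) ⊕ v  ≡⟨ ⊕-assoc u v v ⟩
  u ⊕ (v ⊕ v)  ≡⟨ cong (u ⊕_) (⊕-self v) ⟩
  u ⊕ 0v       ≡⟨ ⊕-identityʳ u ⟩
  u            ∎
  where open ≡-Reasoning

⊕-cancelˡ : (u v : Vec Bool n) → u ⊕ (u ⊕ v) ≡ v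
⊕-cancelˡ u v = begin
  u ⊕ (u ⊕ v)  ≡⟨ ⊕-assoc u u v ⟨
  (u ⊕ u) ⊕ v  ≡⟨ cong (_⊕ v) (⊕-self u) ⟩
  0v ⊕ v       ≡⟨ ⊕-identityˡ v ⟩
  v            ∎
  where open ≡-Reasoning

⊕-swapʳ : (u r v : Vec Bool n) → (u ⊕ r) ⊕ v ≡ (u ⊕ v) ⊕ r
⊕-swapʳ u r v = begin
  (u ⊕ r) ⊕ v  ≡⟨ ⊕-assoc u r v ⟩
  u ⊕ (r ⊕ v)  ≡⟨ cong (u ⊕_) (⊕-comm r v) ⟩
  u ⊕ (v ⊕ r)  ≡⟨ ⊕-assoc u v r ⟨
  (u ⊕ v) ⊕ r  ∎
  where open ≡-Reasoning

⊕-shift-both : (u v r : Vec Bool n) → (u ⊕ r) ⊕ (v ⊕ r) ≡ u ⊕ v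
⊕-shift-both u v r = begin
  (u ⊕ r) ⊕ (v ⊕ r)  ≡⟨ ⊕-assoc (u ⊕ r) v r ⟨
  ((u ⊕ r) ⊕ v) ⊕ r  ≡⟨ cong (_⊕ r) (⊕-swapʳ u r v) ⟩
  ((u ⊕ v) ⊕ r) ⊕ r  ≡⟨ ⊕-cancelʳ (u ⊕ v) r ⟩
  u ⊕ v              ∎
  where open ≡-Reasoning

⊕≡0v⇒≡ : (u v : Vec Bool n) → u ⊕ v ≡ 0v → u ≡ v
⊕≡0v⇒≡ u v h = trans (sym (⊕-cancelʳ u v)) (trans (cong (_⊕ v) h) (⊕-identityˡ v))

isZero⇒≡0v : {v : Vec Bool n} → isZero v ≡ true → v ≡ 0v
isZero⇒≡0v {v = []} _ = refl
isZero⇒≡0v {v = false ∷ v} h = cong (false ∷_) (isZero⇒≡0v h)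

isZero-0v : isZero (0v {n}) ≡ true
isZero-0v {zero} = refl
isZero-0v {suc n} = isZero-0v {n}

isZero-false⇒≢0v : {v : Vec Bool n} → isZero v ≡ false → v ≢ 0v
isZero-false⇒≢0v {n} h refl = true≢false (isZero-0v {n}) h

infix 4 _==_
_==_ : Vec Bool n → Vec Bool n → Bool
u == v = isZero (u ⊕ v)

==-sound : {u v : Vec Bool n} → (u == v) ≡ true → u ≡ v
==-sound {u = u} {v} h = ⊕≡0v⇒≡ u v (isZero⇒≡0v h)

==-false : {u v : Vec Bool n} → u ≢ v → (u == v) ≡ false
==-false {u = u} {v} u≢v with u == v in eq
... | true = ⊥-elim (u≢v (==-sound eq))
... | false = refl

==-refl : (v : Vec Bool n) → (v == v) ≡ true
==-refl {n} v = subst (λ w → isZero w ≡ true) (sym (⊕-self v)) (isZero-0v {n})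

span-0v : (gs : List (Vec Bool n)) → span gs 0v ≡ true
span-0v {n} [] = isZero-0v {n}
span-0v (g ∷ gs) = cong (_∨ span gs (0v ⊕ g)) (span-0v gs)

span-closed : (gs : List (Vec Bool n)) (u v : Vec Bool n) →
              span gs u ≡ true → span gs v ≡ true → span gs (u ⊕ v) ≡ true
span-closed {n} [] u v hu hv = subst (λ w → isZero w ≡ true)
  (sym (trans (cong₂ _⊕_ (isZero⇒≡0v {v = u} hu) (isZero⇒≡0v {v = v} hv)) (⊕-self (0v {n})))) (isZero-0v {n})
span-closed (g ∷ gs) u v hu hv with ∨-elim {span gs u} hu | ∨-elim {span gs v} hv
... | inj₁ su | inj₁ sv = cong (_∨ span gs ((u ⊕ v) ⊕ g)) (span-closed gs u v su sv)
... | inj₁ su | inj₂ sv = ∨-introʳ {span gs (u ⊕ v)}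
  (subst (λ w → span gs w ≡ true) (sym (⊕-assoc u v g)) (span-closed gs u (v ⊕ g) su sv))
... | inj₂ su | inj₁ sv = ∨-introʳ {span gs (u ⊕ v)}
  (subst (λ w → span gs w ≡ true) (⊕-swapʳ u g v) (span-closed gs (u ⊕ g) v su sv))
... | inj₂ su | inj₂ sv = cong (_∨ span gs ((u ⊕ v) ⊕ g))
  (subst (λ w → span gs w ≡ true) (⊕-shift-both u v g) (span-closed gs (u ⊕ g) (v ⊕ g) su sv))

span-head : (g : Vec Bool n) (gs : List (Vec Bool n)) → span (g ∷ gs) g ≡ true
span-head g gs = ∨-introʳ {span gs g} (subst (λ w → span gs w ≡ true) (sym (⊕-self g)) (span-0v gs))

span-generators : (gs : List (Vec Bool n)) → All (λ g → span gs g ≡ true) gs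
span-generators [] = []
span-generators (g ∷ gs) = span-head g gs ∷ All.map (λ {h} sh → cong (_∨ span gs (h ⊕ g)) sh) (span-generators gs)

span-minimal : (A : VSet n) → IsSubspace A → (gs : List (Vec Bool n)) →
               All (λ g → A g ≡ true) gs → span gs ⊆ A
span-minimal A (A0 , _) [] [] v h rewrite isZero⇒≡0v {v = v} h = A0
span-minimal A A-sub (g ∷ gs) (Ag ∷ Ags) v h with ∨-elim {span gs v} h
... | inj₁ s = span-minimal A A-sub gs Ags v s
... | inj₂ s = subst (λ w → A w ≡ true) (⊕-cancelʳ v g)
                 (proj₂ A-sub _ _ (span-minimal A A-sub gs Ags (v ⊕ g) s) Ag)

join-shift : (P : V6) (ℓ : VSet 6) (v : V6) → join P ℓ (v ⊕ P) ≡ join P ℓ v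
join-shift P ℓ v = trans (cong (ℓ (v ⊕ P) ∨_) (cong ℓ (⊕-cancelʳ v P))) (∨-comm (ℓ (v ⊕ P)) (ℓ v))

join-base : (P : V6) (ℓ : VSet 6) → ℓ 0v ≡ true → join P ℓ P ≡ true
join-base P ℓ ℓ0 = ∨-introʳ {ℓ P} (subst (λ w → ℓ w ≡ true) (sym (⊕-self P)) ℓ0)

join-isSubspace : (P : V6) (ℓ : VSet 6) → IsSubspace ℓ → IsSubspace (join P ℓ)
join-isSubspace P ℓ (ℓ0 , ℓ-closed) = cong (_∨ ℓ (0v ⊕ P)) ℓ0 , closed
  where
  closed : ∀ u v → join P ℓ u ≡ true → join P ℓ v ≡ true → join P ℓ (u ⊕ v) ≡ true
  closed u v hu hv with ∨-elim {ℓ u} hu | ∨-elim {ℓ v} hv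
  ... | inj₁ lu | inj₁ lv = cong (_∨ ℓ ((u ⊕ v) ⊕ P)) (ℓ-closed u v lu lv)
  ... | inj₁ lu | inj₂ lv =
    ∨-introʳ {ℓ (u ⊕ v)} (subst (λ w → ℓ w ≡ true) (sym (⊕-assoc u v P)) (ℓ-closed _ _ lu lv))
  ... | inj₂ lu | inj₁ lv =
    ∨-introʳ {ℓ (u ⊕ v)} (subst (λ w → ℓ w ≡ true) (⊕-swapʳ u P v) (ℓ-closed _ _ lu lv))
  ... | inj₂ lu | inj₂ lv =
    cong (_∨ ℓ ((u ⊕ v) ⊕ P)) (subst (λ w → ℓ w ≡ true) (⊕-shift-both u v P) (ℓ-closed _ _ lu lv))

⊆⇒∧≡ : {A B : VSet n} → A ⊆ B → ∀ v → (B v ∧ A v) ≡ A v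
⊆⇒∧≡ {A = A} {B} A⊆B v with A v in Av
... | true = cong (_∧ true) (A⊆B v Av)
... | false = ∧-zeroʳ (B v)

⊆-antisym : {A B : VSet n} → A ⊆ B → B ⊆ A → A ≐ B
⊆-antisym {A = A} {B} A⊆B B⊆A v with A v in Av | B v in Bv
... | true | true = refl
... | false | false = refl
... | true | false = ⊥-elim (true≢false (A⊆B v Av) Bv)
... | false | true = ⊥-elim (true≢false (B⊆A v Bv) Av)

Disjoint-sym : {ℓ m : VSet 6} → Disjoint ℓ m → Disjoint m ℓ
Disjoint-sym d v mv ℓv = d v ℓv mv

disjoint-point : {ℓ X : VSet 6} {v : V6} → Disjoint ℓ X → ℓ v ≡ true → IsPoint v → X v ≡ false
disjoint-point {X = X} {v} d ℓv v≠0 with X v in Xv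
... | false = refl
... | true = ⊥-elim (isZero-false⇒≢0v v≠0 (d v ℓv Xv))

module _ {Sg ℓ : VSet 6} (ℓ-TI : IsTILineIn Sg ℓ) where

  TI-subspace : IsSubspace ℓ
  TI-subspace = proj₁ ℓ-TI

  TI-card : card ℓ ≡ 4
  TI-card = proj₁ (proj₂ ℓ-TI)

  TI-⊆ : ℓ ⊆ Sg
  TI-⊆ = proj₁ (proj₂ (proj₂ ℓ-TI))

∈-allVecs : (v : Vec Bool n) → v ∈ allVecs n
∈-allVecs [] = here refl
∈-allVecs {suc n} (false ∷ v) = ∈-++⁺ˡ (∈-map⁺ (false ∷_) (∈-allVecs v))
∈-allVecs {suc n} (true ∷ v) = ∈-++⁺ʳ (List.map (false ∷_) (allVecs n)) (∈-map⁺ (true ∷_) (∈-allVecs v))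

decide : (f : Vec Bool n → Bool) → all f (allVecs n) ≡ true → ∀ v → f v ≡ true
decide f h v = T⇒≡ (All.lookup (all⁺ f (allVecs _) (≡⇒T h)) (∈-allVecs v))

search : (f : Vec Bool n → Bool) → any f (allVecs n) ≡ true → ∃ λ v → f v ≡ true
search f h with Any.satisfied (any⁻ f (allVecs _) (≡⇒T h))
... | v , fv = v , T⇒≡ fv

search-or-none : (f : Vec Bool n → Bool) → (∃ λ v → f v ≡ true) ⊎ (∀ v → f v ≡ false)
search-or-none {n} f with any f (allVecs n) in h
... | true = inj₁ (search f h)
... | false = inj₂ none
  where
  none : ∀ v → f v ≡ false
  none v with f v in fv
  ... | false = refl
  ... | true = ⊥-elim (true≢false
          (T⇒≡ (any⁺ f (Any.map (λ { refl → ≡⇒T fv }) (∈-allVecs v)))) h)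

count : (Vec Bool n → Bool) → List (Vec Bool n) → ℕ
count f xs = List.length (List.filterᵇ f xs)

count-ext : {f g : Vec Bool n → Bool} → (∀ x → f x ≡ g x) → ∀ xs → count f xs ≡ count g xs
count-ext h [] = refl
count-ext {f = f} {g} h (x ∷ xs) with f x | g x | h x
... | true  | true  | refl = cong suc (count-ext h xs)
... | false | false | refl = count-ext h xs

count-mono : {f g : Vec Bool n → Bool} → (∀ x → f x ≡ true → g x ≡ true) → ∀ xs → count f xs ≤ count g xs
count-mono h [] = z≤n
count-mono {f = f} {g} h (x ∷ xs) with f x in fx | g x in gx
... | true  | true  = s≤s (count-mono h xs)
... | true  | false = ⊥-elim (true≢false (h x fx) gx)
... | false | true  = m≤n⇒m≤1+n (count-mono h xs)
... | false | false = count-mono h xs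

count-split : (f g : Vec Bool n → Bool) → ∀ xs →
              count f xs ≡ count (λ x → f x ∧ g x) xs + count (λ x → f x ∧ not (g x)) xs
count-split f g [] = refl
count-split f g (x ∷ xs) with f x | g x
... | true  | true  = cong suc (count-split f g xs)
... | true  | false = trans (cong suc (count-split f g xs)) (sym (+-suc _ _))
... | false | _     = count-split f g xs

count≡0 : (f : Vec Bool n → Bool) → ∀ {x} xs → count f xs ≡ 0 → x ∈ xs → f x ≡ false
count≡0 f (y ∷ xs) h (here refl) with f y
... | false = refl
count≡0 f (y ∷ xs) h (there x∈xs) with f y
... | false = count≡0 f xs h x∈xs

count-++ : (f : Vec Bool n → Bool) → ∀ xs ys → count f (xs ++ ys) ≡ count f xs + count f ys
count-++ f [] ys = refl
count-++ f (x ∷ xs) ys with f x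
... | true  = cong suc (count-++ f xs ys)
... | false = count-++ f xs ys

count-map : {m : ℕ} (f : Vec Bool n → Bool) (g : Vec Bool m → Vec Bool n) → ∀ xs →
            count f (List.map g xs) ≡ count (f ∘ g) xs
count-map f g [] = refl
count-map f g (x ∷ xs) with f (g x)
... | true  = cong suc (count-map f g xs)
... | false = count-map f g xs

card-split-head : (A : VSet (suc n)) → card A ≡ card (A ∘ (false ∷_)) + card (A ∘ (true ∷_))
card-split-head {n} A = trans (count-++ A (List.map (false ∷_) (allVecs n)) _)
  (cong₂ _+_ (count-map A (false ∷_) (allVecs n)) (count-map A (true ∷_) (allVecs n)))

card-shift : (p : Vec Bool n) (A : VSet n) → card (λ v → A (v ⊕ p)) ≡ card A
card-shift [] A = count-ext {f = λ v → A (v ⊕ [])} {A} (λ { [] → refl }) (allVecs 0)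
card-shift (b ∷ p) A = begin
  card (λ v → A (v ⊕ (b ∷ p)))
    ≡⟨ card-split-head (λ v → A (v ⊕ (b ∷ p))) ⟩
  card (λ w → A (b ∷ (w ⊕ p))) + card (λ w → A (not b ∷ (w ⊕ p)))
    ≡⟨ cong₂ _+_ (card-shift p (A ∘ (b ∷_))) (card-shift p (A ∘ (not b ∷_))) ⟩
  card (A ∘ (b ∷_)) + card (A ∘ (not b ∷_))
    ≡⟨ halves b ⟩
  card (A ∘ (false ∷_)) + card (A ∘ (true ∷_))
    ≡⟨ card-split-head A ⟨
  card A ∎
  where
  open ≡-Reasoning
  halves : ∀ b → card (A ∘ (b ∷_)) + card (A ∘ (not b ∷_)) ≡ card (A ∘ (false ∷_)) + card (A ∘ (true ∷_))
  halves false = refl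
  halves true = +-comm (card (A ∘ (true ∷_))) _

card≡0 : (A : VSet n) → card A ≡ 0 → ∀ v → A v ≡ false
card≡0 {n} A h v = count≡0 A (allVecs n) h (∈-allVecs v)

card-⊆-split : (A B : VSet n) → A ⊆ B → card B ≡ card A + card (λ w → B w ∧ not (A w))
card-⊆-split {n} A B A⊆B =
  trans (count-split B A (allVecs n)) (cong (_+ card (λ w → B w ∧ not (A w))) (count-ext (⊆⇒∧≡ A⊆B) (allVecs n)))

card-⊆-≡ : (A B : VSet n) → A ⊆ B → card A ≡ card B → B ⊆ A
card-⊆-≡ A B A⊆B eq v Bv with A v in Av
... | true = refl
... | false = ⊥-elim (true≢false (∧-intro {B v} Bv (not-false Av)) (card≡0 _ rest≡0 v))
  where
  rest≡0 : card (λ w → B w ∧ not (A w)) ≡ 0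
  rest≡0 = sym (+-cancelˡ-≡ (card A) _ _ (trans (+-identityʳ (card A)) (trans eq (card-⊆-split A B A⊆B))))

coset-cover : (p : Vec Bool n) (A B : VSet n) → A ⊆ B → (∀ v → B (v ⊕ p) ≡ B v) →
              (∀ v → A v ≡ true → A (v ⊕ p) ≡ false) → card B ≡ card A + card A →
              ∀ v → B v ≡ true → A v ≡ true ⊎ A (v ⊕ p) ≡ true
coset-cover {n} p A B A⊆B B-shift A-apart eq v Bv with A v in Av | A (v ⊕ p) in Avp
... | true | _ = inj₁ refl
... | false | true = inj₂ refl
... | false | false = ⊥-elim (true≢false
        (∧-intro {outside v} (∧-intro {B v} Bv (not-false Av)) (not-false Avp)) (card≡0 _ rest≡0 v))
  where
  outside : VSet n
  outside w = B w ∧ not (A w)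
  translate : ∀ w → (outside w ∧ A (w ⊕ p)) ≡ A (w ⊕ p)
  translate w with A (w ⊕ p) in Awp
  ... | false = ∧-zeroʳ (outside w)
  ... | true rewrite sym (B-shift w) | A⊆B (w ⊕ p) Awp
                   | subst (λ u → A u ≡ false) (⊕-cancelʳ w p) (A-apart (w ⊕ p) Awp) = refl
  rest : ℕ
  rest = card (λ w → outside w ∧ not (A (w ⊕ p)))
  rest≡0 : rest ≡ 0
  rest≡0 = sym (+-cancelˡ-≡ (card A + card A) _ _ (begin
    (card A + card A) + 0  ≡⟨ +-identityʳ _ ⟩
    card A + card A        ≡⟨ eq ⟨
    card B                 ≡⟨ card-⊆-split A B A⊆B ⟩
    card A + card outside  ≡⟨ cong (card A +_) (count-split outside (λ w → A (w ⊕ p)) (allVecs n)) ⟩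
    card A + (card (λ w → outside w ∧ A (w ⊕ p)) + rest)
      ≡⟨ cong (λ k → card A + (k + rest)) (trans (count-ext translate (allVecs n)) (card-shift p A)) ⟩
    card A + (card A + rest)   ≡⟨ +-assoc (card A) (card A) rest ⟨
    (card A + card A) + rest   ∎))
    where open ≡-Reasoning

≐-card : {A B : VSet n} → A ≐ B → card A ≡ card B
≐-card {n} A≐B = count-ext A≐B (allVecs n)

module _ {A : Set} where

  all-any-zip : {P Q : A → Set} {xs : List A} → All P xs → Any Q xs → Any (λ x → P x × Q x) xs
  all-any-zip (p ∷ _) (here q) = here (p , q)
  all-any-zip (_ ∷ ps) (there q) = there (all-any-zip ps q)

  module _ {R : A → A → Set} (R-sym : ∀ {x z} → R x z → R z x) where

    equal-or-related : {B : A → Set} {xs : List A} → AllPairs R xs → Any B xs →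
                       All (λ x → B x ⊎ (∃[ z ] (B z × R x z))) xs
    equal-or-related {xs = x ∷ _} (Rx ∷ _) (here b) = inj₁ b ∷ All.map (λ r → inj₂ (x , b , R-sym r)) Rx
    equal-or-related (Rx ∷ Rxs) (there b) with All.lookupAny Rx b
    ... | r , bz = inj₂ (_ , bz , r) ∷ equal-or-related Rxs b

    same-or-related : {B C : A → Set} {xs : List A} → AllPairs R xs → Any B xs → Any C xs →
                      Any (λ x → B x × C x) xs ⊎ (∃₂ λ x z → B x × C z × R x z)
    same-or-related _ (here b) (here c) = inj₁ (here (b , c))
    same-or-related (Rx ∷ _) (here b) (there c) with All.lookupAny Rx c
    ... | r , cz = inj₂ (_ , _ , b , cz , r)
    same-or-related (Rx ∷ _) (there b) (here c) with All.lookupAny Rx b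
    ... | r , bz = inj₂ (_ , _ , bz , c , R-sym r)
    same-or-related (_ ∷ Rxs) (there b) (there c) with same-or-related Rxs b c
    ... | inj₁ bc = inj₁ (there bc)
    ... | inj₂ related = inj₂ related

-- Symmetric matrices and the explicit code

symMat : Vec Bool 6 → Mat3
symMat (a ∷ b ∷ c ∷ d ∷ e ∷ f ∷ []) =
  (a ∷ b ∷ c ∷ []) ∷ (b ∷ d ∷ e ∷ []) ∷ (c ∷ e ∷ f ∷ []) ∷ []

upper : Mat3 → Vec Bool 6
upper ((a ∷ b ∷ c ∷ []) ∷ (_ ∷ d ∷ e ∷ []) ∷ (_ ∷ _ ∷ f ∷ []) ∷ []) =
  a ∷ b ∷ c ∷ d ∷ e ∷ f ∷ []

symMat-upper : (S : Mat3) → IsSym S → symMat (upper S) ≡ S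
symMat-upper ((a ∷ b ∷ c ∷ []) ∷ (b′ ∷ d ∷ e ∷ []) ∷ (c′ ∷ e′ ∷ f ∷ []) ∷ []) S-sym
  rewrite S-sym (Fin.suc Fin.zero) Fin.zero | S-sym (Fin.suc (Fin.suc Fin.zero)) Fin.zero
        | S-sym (Fin.suc (Fin.suc Fin.zero)) (Fin.suc Fin.zero) = refl

symMat-isSym : (s : Vec Bool 6) → IsSym (symMat s)
symMat-isSym (a ∷ b ∷ c ∷ d ∷ e ∷ f ∷ []) = λ where
  Fin.zero Fin.zero → refl
  Fin.zero (Fin.suc Fin.zero) → refl
  Fin.zero (Fin.suc (Fin.suc Fin.zero)) → refl
  (Fin.suc Fin.zero) Fin.zero → refl
  (Fin.suc Fin.zero) (Fin.suc Fin.zero) → refl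
  (Fin.suc Fin.zero) (Fin.suc (Fin.suc Fin.zero)) → refl
  (Fin.suc (Fin.suc Fin.zero)) Fin.zero → refl
  (Fin.suc (Fin.suc Fin.zero)) (Fin.suc Fin.zero) → refl
  (Fin.suc (Fin.suc Fin.zero)) (Fin.suc (Fin.suc Fin.zero)) → refl

upper-symMat : ∀ s → upper (symMat s) ≡ s
upper-symMat (a ∷ b ∷ c ∷ d ∷ e ∷ f ∷ []) = refl

diagonal : Vec Bool 6 → Bool
diagonal (a ∷ _ ∷ _ ∷ d ∷ _ ∷ f ∷ []) = a ∨ d ∨ f

inCode : Vec Bool 6 → Bool
inCode s = isZero s ∨ ((rk (symMat s) ≡ᵇ 2) ∧ diagonal s)

-- For P = (x, 0), symMat (alt P) is the matrix of w ↦ x × w: the alternating matrix with kernel x.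
alt : V6 → Vec Bool 6
alt (x₁ ∷ x₂ ∷ x₃ ∷ _) = false ∷ x₃ ∷ x₂ ∷ false ∷ x₁ ∷ false ∷ []

rows : Vec Bool 6 → List V6
rows s = Vec.toList (Vec.zipWith Vec._++_ I₃ (symMat s))

L-determined : ∀ s s′ → L (symMat s) ≐ L (symMat s′) → s ≡ s′
L-determined s s′ L≐ = ==-sound (mp (decide (at-s′ s) (decide at-s refl s) s′) rows-in)
  where
  at-s′ : Vec Bool 6 → Vec Bool 6 → Bool
  at-s′ s s′ = all (L (symMat s)) (rows s′) ⇒ᵇ (s == s′)
  at-s : Vec Bool 6 → Bool
  at-s s = all (at-s′ s) (allVecs 6)
  rows-in : all (L (symMat s)) (rows s′) ≡ true
  rows-in = T⇒≡ (all⁻ (L (symMat s))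
    (All.map (λ {g} h → ≡⇒T (trans (L≐ g) h)) (span-generators (rows s′))))

code-distance : ∀ s s′ → inCode s ≡ true → inCode s′ ≡ true → s ≢ s′ → 2 ≤ rk (symMat s ⊟ symMat s′)
code-distance s s′ cs cs′ s≢s′ = conclude (∨-elim (mp (decide (at-s′ s) (mp (decide at-s refl s) cs) s′) cs′))
  where
  at-s′ : Vec Bool 6 → Vec Bool 6 → Bool
  at-s′ s s′ = inCode s′ ⇒ᵇ (s == s′) ∨ (2 ≤ᵇ rk (symMat s ⊟ symMat s′))
  at-s : Vec Bool 6 → Bool
  at-s s = inCode s ⇒ᵇ all (at-s′ s) (allVecs 6)
  conclude : (s == s′) ≡ true ⊎ (2 ≤ᵇ rk (symMat s ⊟ symMat s′)) ≡ true → 2 ≤ rk (symMat s ⊟ symMat s′)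
  conclude (inj₁ s≡s′) = ⊥-elim (s≢s′ (==-sound s≡s′))
  conclude (inj₂ 2≤rk) = ≤ᵇ⇒≤ 2 _ (≡⇒T 2≤rk)

code-maximal : ∀ s′ → inCode s′ ≡ false → ∃ λ s → inCode s ≡ true × ¬ (2 ≤ rk (symMat s′ ⊟ symMat s))
code-maximal s′ cs′ = conclude (search (near s′) (mp (decide at-s′ refl s′) (not-false cs′)))
  where
  near : Vec Bool 6 → Vec Bool 6 → Bool
  near s′ s = inCode s ∧ not (2 ≤ᵇ rk (symMat s′ ⊟ symMat s))
  at-s′ : Vec Bool 6 → Bool
  at-s′ s′ = not (inCode s′) ⇒ᵇ any (near s′) (allVecs 6)
  conclude : (∃ λ s → near s′ s ≡ true) → ∃ λ s → inCode s ≡ true × ¬ (2 ≤ rk (symMat s′ ⊟ symMat s))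
  conclude (s , h) = s , proj₁ (∧-elim {inCode s} h) ,
    λ 2≤rk → true≢false (T⇒≡ (≤⇒≤ᵇ 2≤rk)) (not-true (proj₂ (∧-elim {inCode s} h)))

-- Finite facts about W(5,2)

pointΠ₂ᵇ : V6 → Bool
pointΠ₂ᵇ v = not (isZero v) ∧ Π₂ v

pointΠ₂-intro : ∀ P → IsPoint P → Π₂ P ≡ true → pointΠ₂ᵇ P ≡ true
pointΠ₂-intro P P≠0 P∈Π₂ = ∧-intro (not-false P≠0) P∈Π₂

offΠᵇ : V6 → Bool
offΠᵇ v = not (isZero v) ∧ not (Π₁ v) ∧ not (Π₂ v)

offᵇ : V6 → V6 → Bool
offᵇ P v = offΠᵇ v ∧ not (Π₁ (v ⊕ P))

-- P, y, b span a totally isotropic plane meeting Π₁ in 0 and Π₂ in ⟨P⟩.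
validᵇ : V6 → V6 → V6 → Bool
validᵇ P y b = perp P y ∧ perp P b ∧ not (form y b) ∧ offᵇ P y ∧ offᵇ P b ∧ offᵇ P (y ⊕ b)

plane : V6 → V6 → V6 → VSet 6
plane P y b = span (P ∷ y ∷ b ∷ [])

liftableᵇ : V6 → V6 → Bool
liftableᵇ P y =
  perp P y ∧ offΠᵇ y ∧ offΠᵇ (y ⊕ P) ∧ not (L (symMat (alt P)) y) ∧ not (L (symMat (alt P)) (y ⊕ P))

isLiftᵇ : V6 → V6 → V6 → Bool
isLiftᵇ P y₀ y = (y == y₀) ∨ (y == y₀ ⊕ P)

lift-cases : ∀ {P y₀ y} (f : V6 → Bool) → isLiftᵇ P y₀ y ≡ true →
             f y₀ ≡ true → f (y₀ ⊕ P) ≡ true → f y ≡ true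
lift-cases {P} {y₀} {y} f h f₀ f₁ with ∨-elim {y == y₀} h
... | inj₁ e = subst (λ w → f w ≡ true) (sym (==-sound e)) f₀
... | inj₂ e = subst (λ w → f w ≡ true) (sym (==-sound e)) f₁

-- Points chosen by search; the properties used of them are verified by exhaustive checks.
firstWith : (V6 → Bool) → V6
firstWith f = List.foldr (λ v r → if f v then v else r) 0v (allVecs 6)

seedIn : V6 → VSet 6 → V6
seedIn P π = firstWith (λ y → π y ∧ liftableᵇ P y)

kernelPoint : Vec Bool 6 → V6
kernelPoint s = firstWith (λ v → pointΠ₂ᵇ v ∧ L (symMat s) v)

meetsAltᵇ : V6 → V6 → V6 → V6 → Bool
meetsAltᵇ P y b z = not (isZero z) ∧ not (z == P) ∧ L (symMat (alt P)) z ∧ plane P y b z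

planes-through-seedᵇ : V6 → V6 → (V6 → V6 → Bool) → Bool
planes-through-seedᵇ P y₀ good = liftableᵇ P y₀ ∧
  all (λ y → isLiftᵇ P y₀ y ⇒ᵇ all (λ b → validᵇ P y b ⇒ᵇ good y b) (allVecs 6)) (allVecs 6)

liftable-off-alt : ∀ {P y₀} → liftableᵇ P y₀ ≡ true →
                   not (L (symMat (alt P)) y₀) ≡ true × not (L (symMat (alt P)) (y₀ ⊕ P)) ≡ true
liftable-off-alt {P} {y₀} h = ∧-elim {not (L (symMat (alt P)) y₀)}
  (proj₂ (∧-elim {offΠᵇ (y₀ ⊕ P)} (proj₂ (∧-elim {offΠᵇ y₀} (proj₂ (∧-elim {perp P y₀} h))))))

meetsAlt-parts : ∀ {P y b z} → meetsAltᵇ P y b z ≡ true →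
                 IsPoint z × (z == P) ≡ false × L (symMat (alt P)) z ≡ true × plane P y b z ≡ true
meetsAlt-parts {P} {y} {b} {z} h with ∧-elim {not (isZero z)} h
... | z≠0 , h₁ with ∧-elim {not (z == P)} h₁
...   | z≠P , h₂ with ∧-elim {L (symMat (alt P)) z} h₂
...     | alt-z , plane-z = not-true z≠0 , not-true z≠P , alt-z , plane-z

perp-card : ∀ P → IsPoint P → card (perp P) ≡ 32
perp-card P P≠0 = ≡ᵇ⇒≡ _ 32 (≡⇒T (mp (decide at-P refl P) (not-false P≠0)))
  where
  at-P : V6 → Bool
  at-P P = not (isZero P) ⇒ᵇ (card (perp P) ≡ᵇ 32)

perp-translate : ∀ P v → perp P (v ⊕ P) ≡ perp P v
perp-translate P v = xnor-sound (decide (at-v P) (decide (λ P → all (at-v P) (allVecs 6)) refl P) v)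
  where
  at-v : V6 → V6 → Bool
  at-v P v = not (perp P (v ⊕ P) xor perp P v)

Π₁-perp-card : ∀ P → IsPoint P → Π₂ P ≡ true → card (Π₁ ∩ perp P) ≡ 4
Π₁-perp-card P P≠0 P∈Π₂ = ≡ᵇ⇒≡ _ 4 (≡⇒T (mp (decide at-P refl P) (pointΠ₂-intro P P≠0 P∈Π₂)))
  where
  at-P : V6 → Bool
  at-P P = pointΠ₂ᵇ P ⇒ᵇ (card (Π₁ ∩ perp P) ≡ᵇ 4)

pair-card : ∀ y → card (λ v → isZero v ∨ (v == y)) ≤ 2
pair-card y = ≤ᵇ⇒≤ _ 2 (≡⇒T (decide at-y refl y))
  where
  at-y : V6 → Bool
  at-y y = card (λ v → isZero v ∨ (v == y)) ≤ᵇ 2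

plane-maximal : ∀ {P y b w} → IsPoint P → Π₂ P ≡ true → validᵇ P y b ≡ true →
                perp P w ≡ true → form y w ≡ false → form b w ≡ false → plane P y b w ≡ true
plane-maximal {P} {y} {b} {w} P≠0 P∈Π₂ valid Pw yw bw =
  mp (decide (at-w P y b) (mp (decide (at-b P y) (decide (at-y P)
       (mp (decide at-P refl P) (pointΠ₂-intro P P≠0 P∈Π₂)) y) b) valid) w)
     (∧-intro Pw (∧-intro (not-false yw) (not-false bw)))
  where
  at-w : V6 → V6 → V6 → V6 → Bool
  at-w P y b w = (perp P w ∧ not (form y w) ∧ not (form b w)) ⇒ᵇ plane P y b w
  at-b : V6 → V6 → V6 → Bool
  at-b P y b = validᵇ P y b ⇒ᵇ all (at-w P y b) (allVecs 6)
  at-y : V6 → V6 → Bool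
  at-y P y = all (at-b P y) (allVecs 6)
  at-P : V6 → Bool
  at-P P = pointΠ₂ᵇ P ⇒ᵇ all (at-y P) (allVecs 6)

inCode-of-trace : ∀ {P} s → IsPoint P → Π₂ P ≡ true → L (symMat s) P ≡ true → s ≢ alt P →
                  (∀ v → L (symMat s) v ≡ true → Π₂ v ≡ true → v ≡ 0v ⊎ v ≡ P) → inCode s ≡ true
inCode-of-trace {P} s P≠0 P∈Π₂ LP s≢alt trace with inCode s in cs
... | true = refl
... | false = ⊥-elim (excluded (search (extra P s)
        (∨-elim-false cs (mp (mp (decide (at-s P) (mp (decide at-P refl P) (pointΠ₂-intro P P≠0 P∈Π₂)) s)
          LP) (not-false (==-false s≢alt))))))
  where
  extra : V6 → Vec Bool 6 → V6 → Bool
  extra P s v = L (symMat s) v ∧ Π₂ v ∧ not (isZero v) ∧ not (v == P)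
  at-s : V6 → Vec Bool 6 → Bool
  at-s P s = L (symMat s) P ⇒ᵇ not (s == alt P) ⇒ᵇ inCode s ∨ any (extra P s) (allVecs 6)
  at-P : V6 → Bool
  at-P P = pointΠ₂ᵇ P ⇒ᵇ all (at-s P) (allVecs 6)
  excluded : (∃ λ v → extra P s v ≡ true) → ⊥
  excluded (v , h) with ∧-elim {L (symMat s) v} h
  ... | Lv , rest with ∧-elim {Π₂ v} rest
  ...   | Π₂v , rest′ with ∧-elim {not (isZero v)} rest′
  ...     | v≠0 , v≠P with trace v Lv Π₂v
  ...       | inj₁ refl = true≢false (isZero-0v {6}) (not-true v≠0)
  ...       | inj₂ refl = true≢false (==-refl P) (not-true v≠P)

record Seed (P : V6) (Good : V6 → V6 → Set) : Set where
  field
    y₀ : V6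
    liftable : liftableᵇ P y₀ ≡ true
    good : ∀ y b → isLiftᵇ P y₀ y ≡ true → validᵇ P y b ≡ true → Good y b

seed-of-check : ∀ {P y₀} (good : V6 → V6 → Bool) → planes-through-seedᵇ P y₀ good ≡ true →
                Seed P (λ y b → good y b ≡ true)
seed-of-check {P} {y₀} good h = record
  { y₀ = y₀
  ; liftable = proj₁ (∧-elim {liftableᵇ P y₀} h)
  ; good = λ y b isLift valid →
      mp (decide (at-b y) (mp (decide at-y (proj₂ (∧-elim {liftableᵇ P y₀} h)) y) isLift) b) valid
  }
  where
  at-b : V6 → V6 → Bool
  at-b y b = validᵇ P y b ⇒ᵇ good y b
  at-y : V6 → Bool
  at-y y = isLiftᵇ P y₀ y ⇒ᵇ all (at-b y) (allVecs 6)

bad-seed : ∀ {P} → IsPoint P → Π₂ P ≡ true → Seed P (λ y b → ∃ λ z → meetsAltᵇ P y b z ≡ true)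
bad-seed {P} P≠0 P∈Π₂ = record
  { y₀ = Seed.y₀ s ; liftable = Seed.liftable s
  ; good = λ y b isLift valid → search (meetsAltᵇ P y b) (Seed.good s y b isLift valid) }
  where
  meets : V6 → V6 → V6 → Bool
  meets P y b = any (meetsAltᵇ P y b) (allVecs 6)
  at-P : V6 → Bool
  at-P P = pointΠ₂ᵇ P ⇒ᵇ planes-through-seedᵇ P (seedIn P (λ _ → true)) (meets P)
  s : Seed P (λ y b → meets P y b ≡ true)
  s = seed-of-check {P} {seedIn P (λ _ → true)} (meets P)
        (mp (decide at-P refl P) (pointΠ₂-intro P P≠0 P∈Π₂))

samePlaneᵇ : Vec Bool 6 → V6 → V6 → V6 → Bool
samePlaneᵇ s P y b = all (λ v → not (L (symMat s) v xor plane P y b v)) (allVecs 6)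

codewordᵇ : Vec Bool 6 → V6 → Bool
codewordᵇ s P = pointΠ₂ᵇ P ∧ planes-through-seedᵇ P (seedIn P (L (symMat s))) (samePlaneᵇ s P)

-- Stated for a variable P, so that type checking never unfolds kernelPoint s symbolically.
codeword-at : ∀ s P → codewordᵇ s P ≡ true →
              IsPoint P × Π₂ P ≡ true × Seed P (λ y b → L (symMat s) ≐ plane P y b)
codeword-at s P h = not-true P≠0 , P∈Π₂ , record
  { y₀ = Seed.y₀ sd ; liftable = Seed.liftable sd
  ; good = λ y b isLift valid v →
      xnor-sound (decide (λ v → not (L (symMat s) v xor plane P y b v)) (Seed.good sd y b isLift valid) v)
  }
  where
  parts = ∧-elim {pointΠ₂ᵇ P} {planes-through-seedᵇ P (seedIn P (L (symMat s))) (samePlaneᵇ s P)} h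
  P≠0 = proj₁ (∧-elim {not (isZero P)} {Π₂ P} (proj₁ parts))
  P∈Π₂ = proj₂ (∧-elim {not (isZero P)} {Π₂ P} (proj₁ parts))
  sd : Seed P (λ y b → samePlaneᵇ s P y b ≡ true)
  sd = seed-of-check {P} {seedIn P (L (symMat s))} (samePlaneᵇ s P) (proj₂ parts)

codeword-seed : ∀ s → inCode s ≡ true → isZero s ≡ false →
                IsPoint (kernelPoint s) × Π₂ (kernelPoint s) ≡ true ×
                Seed (kernelPoint s) (λ y b → L (symMat s) ≐ plane (kernelPoint s) y b)
codeword-seed s cs s≠0 = codeword-at s (kernelPoint s) (mp (decide at-s refl s) (∧-intro cs (not-false s≠0)))
  where
  at-s : Vec Bool 6 → Bool
  at-s s = (inCode s ∧ not (isZero s)) ⇒ᵇ codewordᵇ s (kernelPoint s)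

-- The spread at a point of Π₂

module AtPoint (c : Choice) {P : V6} (P≠0 : IsPoint P) (P∈Π₂ : Π₂ P ≡ true) where

  Sg : VSet 6
  Sg = Sig c P

  lines : List (VSet 6)
  lines = F c P

  private
    Sg-ok = Sig-ok c P P≠0 P∈Π₂
    spread = F-ok c P P≠0 P∈Π₂

  Sg-closed : ∀ u v → Sg u ≡ true → Sg v ≡ true → Sg (u ⊕ v) ≡ true
  Sg-closed = proj₂ (proj₁ Sg-ok)

  Sg⊆P⊥ : Sg ⊆ perp P
  Sg⊆P⊥ = proj₁ (proj₂ (proj₂ Sg-ok))

  lines-TI : All (IsTILineIn Sg) lines
  lines-TI = proj₁ (proj₁ spread)

  Sg-card : card Sg ≡ 16
  Sg-card = proj₁ (proj₂ Sg-ok)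

  P∉Sg : Sg P ≡ false
  P∉Sg = proj₂ (proj₂ (proj₂ Sg-ok))

  lines-disjoint : AllPairs Disjoint lines
  lines-disjoint = proj₁ (proj₂ (proj₁ spread))

  lines-cover : ∀ v → Sg v ≡ true → IsPoint v → Any (λ ℓ → ℓ v ≡ true) lines
  lines-cover = proj₂ (proj₂ (proj₁ spread))

  r-in : Any (λ ℓ → ℓ ≐ (Sg ∩ Π₁)) lines
  r-in = proj₁ (proj₂ spread)

  t-in : Any (λ ℓ → ℓ ≐ (Sg ∩ Π₂)) lines
  t-in = proj₂ (proj₂ spread)

  Sg-apart : ∀ v → Sg v ≡ true → Sg (v ⊕ P) ≡ false
  Sg-apart v Sv with Sg (v ⊕ P) in SvP
  ... | false = refl
  ... | true = ⊥-elim (true≢false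
          (subst (λ w → Sg w ≡ true) (⊕-cancelˡ v P) (Sg-closed v (v ⊕ P) Sv SvP))
          P∉Sg)

  lift : ∀ u → perp P u ≡ true → Sg u ≡ true ⊎ Sg (u ⊕ P) ≡ true
  lift = coset-cover P Sg (perp P) Sg⊆P⊥ (perp-translate P) Sg-apart
           (trans (perp-card P P≠0) (sym (cong (λ k → k + k) Sg-card)))

  Π₁∩P⊥⊆Sg : ∀ v → Π₁ v ≡ true → perp P v ≡ true → Sg v ≡ true
  Π₁∩P⊥⊆Sg v Π₁v P⊥v =
    proj₁ (∧-elim {Sg v} (card-⊆-≡ (Sg ∩ Π₁) (Π₁ ∩ perp P) r⊆ r-card v (∧-intro Π₁v P⊥v)))
    where
    r⊆ : (Sg ∩ Π₁) ⊆ (Π₁ ∩ perp P)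
    r⊆ w h = ∧-intro (proj₂ (∧-elim {Sg w} h)) (Sg⊆P⊥ w (proj₁ (∧-elim {Sg w} h)))
    r-card : card (Sg ∩ Π₁) ≡ card (Π₁ ∩ perp P)
    r-card with All.lookupAny lines-TI r-in
    ... | r-TI , r≐ = trans (sym (≐-card r≐)) (trans (TI-card r-TI) (sym (Π₁-perp-card P P≠0 P∈Π₂)))

  Classified : VSet 6 → Set
  Classified ℓ =
    IsTILineIn Sg ℓ × (ℓ ≐ (Sg ∩ Π₁) ⊎ Disjoint ℓ Π₁) × (ℓ ≐ (Sg ∩ Π₂) ⊎ Disjoint ℓ Π₂)

  classified : All Classified lines
  classified = All.zip (lines-TI , All.zip (sort Π₁ r-in , sort Π₂ t-in))
    where
    sort : ∀ X → Any (λ ℓ → ℓ ≐ (Sg ∩ X)) lines → All (λ ℓ → ℓ ≐ (Sg ∩ X) ⊎ Disjoint ℓ X) lines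
    sort X special = All.map apart (All.zip (lines-TI , equal-or-related Disjoint-sym lines-disjoint special))
      where
      apart : ∀ {ℓ} → IsTILineIn Sg ℓ × (ℓ ≐ (Sg ∩ X) ⊎ ∃[ z ] (z ≐ (Sg ∩ X) × Disjoint ℓ z)) →
              ℓ ≐ (Sg ∩ X) ⊎ Disjoint ℓ X
      apart (_ , inj₁ ℓ≐) = inj₁ ℓ≐
      apart (ℓ-TI , inj₂ (z , z≐ , d)) =
        inj₂ λ v ℓv Xv → d v ℓv (trans (z≐ v) (∧-intro (TI-⊆ ℓ-TI v ℓv) Xv))

  OffLine : VSet 6 → Set
  OffLine ℓ = IsTILineIn Sg ℓ × Disjoint ℓ Π₁ × Disjoint ℓ Π₂

  ≐-outside : ∀ {ℓ X y} → ℓ y ≡ true → X y ≡ false → ¬ ℓ ≐ (Sg ∩ X)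
  ≐-outside {ℓ} {X} {y} ℓy Xy ℓ≐ =
    true≢false ℓy (trans (ℓ≐ y) (trans (cong (Sg y ∧_) Xy) (∧-zeroʳ (Sg y))))

  off-line : ∀ {ℓ} → Classified ℓ → ¬ ℓ ≐ (Sg ∩ Π₁) → ¬ ℓ ≐ (Sg ∩ Π₂) → OffLine ℓ
  off-line (ℓ-TI , sort₁ , sort₂) ℓ≠r ℓ≠t = ℓ-TI , away sort₁ ℓ≠r , away sort₂ ℓ≠t
    where
    away : ∀ {ℓ X} → ℓ ≐ (Sg ∩ X) ⊎ Disjoint ℓ X → ¬ ℓ ≐ (Sg ∩ X) → Disjoint ℓ X
    away (inj₁ ℓ≐) ℓ≠ = ⊥-elim (ℓ≠ ℓ≐)
    away (inj₂ d) _ = d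

  join-Π₂ : ∀ {ℓ} → OffLine ℓ → ∀ v → join P ℓ v ≡ true → Π₂ v ≡ true → v ≡ 0v ⊎ v ≡ P
  join-Π₂ {ℓ} (_ , _ , d₂) v h Π₂v with ∨-elim {ℓ v} h
  ... | inj₁ ℓv = inj₁ (d₂ v ℓv Π₂v)
  ... | inj₂ ℓvP =
    inj₂ (⊕≡0v⇒≡ v P (d₂ (v ⊕ P) ℓvP (span-closed (U₁ ∷ U₂ ∷ U₃ ∷ []) v P Π₂v P∈Π₂)))

  off-point : ∀ {ℓ v} → OffLine ℓ → ℓ v ≡ true → IsPoint v → offᵇ P v ≡ true
  off-point {ℓ} {v} (ℓ-TI , d₁ , d₂) ℓv v≠0 =
    ∧-intro (∧-intro (not-false v≠0)
      (∧-intro (not-false (disjoint-point d₁ ℓv v≠0)) (not-false (disjoint-point d₂ ℓv v≠0))))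
      (not-false vP∉Π₁)
    where
    Sv : Sg v ≡ true
    Sv = TI-⊆ ℓ-TI v ℓv
    vP∉Π₁ : Π₁ (v ⊕ P) ≡ false
    vP∉Π₁ with Π₁ (v ⊕ P) in h
    ... | false = refl
    ... | true = ⊥-elim (true≢false
            (Π₁∩P⊥⊆Sg (v ⊕ P) h (trans (perp-translate P v) (Sg⊆P⊥ v Sv))) (Sg-apart v Sv))

  second-point : ∀ {ℓ} → OffLine ℓ → ∀ y → ∃ λ b → ℓ b ≡ true × IsPoint b × (b == y) ≡ false
  second-point {ℓ} (ℓ-TI , _) y with search-or-none (λ b → ℓ b ∧ not (isZero b) ∧ not (b == y))
  ... | inj₁ (b , h) with ∧-elim {ℓ b} h
  ...   | ℓb , rest = b , ℓb , not-true (proj₁ (∧-elim {not (isZero b)} rest)) ,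
                      not-true (proj₂ (∧-elim {not (isZero b)} rest))
  second-point {ℓ} (ℓ-TI , _) y | inj₂ none = ⊥-elim (4≰2 (begin
      4                                   ≡⟨ TI-card ℓ-TI ⟨
      card ℓ                              ≤⟨ count-mono within (allVecs 6) ⟩
      card (λ v → isZero v ∨ (v == y))    ≤⟨ pair-card y ⟩
      2                                   ∎))
    where
    open ≤-Reasoning
    4≰2 : ¬ 4 ≤ 2
    4≰2 (s≤s (s≤s ()))
    within : ∀ v → ℓ v ≡ true → (isZero v ∨ (v == y)) ≡ true
    within v ℓv with isZero v | v == y | none v
    ... | true | _ | _ = refl
    ... | false | true | _ = refl
    ... | false | false | h rewrite ℓv = ⊥-elim (true≢false refl h)

  pair-valid : ∀ {ℓ y b} → OffLine ℓ → ℓ y ≡ true → ℓ b ≡ true →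
               IsPoint y → IsPoint b → (b == y) ≡ false → validᵇ P y b ≡ true
  pair-valid {ℓ} {y} {b} off@(((_ , ℓ-closed) , _ , ℓ⊆Sg , ℓ-TI) , _) ℓy ℓb y≠0 b≠0 b≠y =
    ∧-intro (Sg⊆P⊥ y (ℓ⊆Sg y ℓy)) (∧-intro (Sg⊆P⊥ b (ℓ⊆Sg b ℓb)) (∧-intro (not-false (ℓ-TI y b ℓy ℓb))
      (∧-intro (off-point off ℓy y≠0) (∧-intro (off-point off ℓb b≠0)
        (off-point off (ℓ-closed y b ℓy ℓb) (trans (cong isZero (⊕-comm y b)) b≠y))))))

  join≐plane : ∀ {ℓ y b} → OffLine ℓ → ℓ y ≡ true → ℓ b ≡ true → validᵇ P y b ≡ true →
               join P ℓ ≐ plane P y b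
  join≐plane {ℓ} {y} {b} ((ℓ-sub , _ , ℓ⊆Sg , ℓ-TI) , _) ℓy ℓb valid = ⊆-antisym join⊆plane plane⊆join
    where
    ℓ⊆plane : ∀ w → ℓ w ≡ true → plane P y b w ≡ true
    ℓ⊆plane w ℓw = plane-maximal {P} {y} {b} {w} P≠0 P∈Π₂ valid
                     (Sg⊆P⊥ w (ℓ⊆Sg w ℓw)) (ℓ-TI y w ℓy ℓw) (ℓ-TI b w ℓb ℓw)
    join⊆plane : join P ℓ ⊆ plane P y b
    join⊆plane w h with ∨-elim {ℓ w} h
    ... | inj₁ ℓw = ℓ⊆plane w ℓw
    ... | inj₂ ℓwP = subst (λ u → plane P y b u ≡ true) (⊕-cancelʳ w P)
                       (span-closed (P ∷ y ∷ b ∷ []) (w ⊕ P) P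
                         (ℓ⊆plane (w ⊕ P) ℓwP) (span-head P (y ∷ b ∷ [])))
    plane⊆join : plane P y b ⊆ join P ℓ
    plane⊆join = span-minimal (join P ℓ) (join-isSubspace P ℓ ℓ-sub) (P ∷ y ∷ b ∷ [])
      (join-base P ℓ (proj₁ ℓ-sub) ∷ cong (_∨ ℓ (y ⊕ P)) ℓy ∷ cong (_∨ ℓ (b ⊕ P)) ℓb ∷ [])

  join∩Sg : ∀ {ℓ w} → IsTILineIn Sg ℓ → Sg w ≡ true → join P ℓ w ≡ true → ℓ w ≡ true
  join∩Sg {ℓ} {w} (_ , _ , ℓ⊆Sg , _) Sw h with ∨-elim {ℓ w} h
  ... | inj₁ ℓw = ℓw
  ... | inj₂ ℓwP = ⊥-elim (true≢false (ℓ⊆Sg (w ⊕ P) ℓwP) (Sg-apart w Sw))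

  ThroughLine : V6 → VSet 6 → Set
  ThroughLine y m = OffLine m × m y ≡ true × ∃ λ b → validᵇ P y b ≡ true × join P m ≐ plane P y b

  record LineThrough (y₀ : V6) : Set where
    field
      y : V6
      y≠0 : IsPoint y
      lift-of : isLiftᵇ P y₀ y ≡ true
      line : Any (ThroughLine y) lines

  line-through : ∀ y₀ → liftableᵇ P y₀ ≡ true → LineThrough y₀
  line-through y₀ h = lifted (lift y₀ (proj₁ (∧-elim {perp P y₀} h)))
    where
    offs : offΠᵇ y₀ ∧ offΠᵇ (y₀ ⊕ P) ∧ _ ≡ true
    offs = proj₂ (∧-elim {perp P y₀} h)
    through : ∀ y → Sg y ≡ true → isLiftᵇ P y₀ y ≡ true → offΠᵇ y ≡ true → LineThrough y₀
    through y Sy lift-of off = record { y = y ; y≠0 = y≠0 ; lift-of = lift-of ; line = Any.map through-m covering }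
      where
      y≠0 : IsPoint y
      y≠0 = not-true (proj₁ (∧-elim {not (isZero y)} off))
      y∉Π₁ : Π₁ y ≡ false
      y∉Π₁ = not-true (proj₁ (∧-elim (proj₂ (∧-elim {not (isZero y)} off))))
      y∉Π₂ : Π₂ y ≡ false
      y∉Π₂ = not-true (proj₂ (∧-elim {not (Π₁ y)} (proj₂ (∧-elim {not (isZero y)} off))))
      covering : Any (λ m → Classified m × m y ≡ true) lines
      covering = all-any-zip classified (lines-cover y Sy y≠0)
      through-m : ∀ {m} → Classified m × m y ≡ true → ThroughLine y m
      through-m (cl , my) with off-line cl (≐-outside my y∉Π₁) (≐-outside my y∉Π₂)
      ... | off-m with second-point off-m y
      ...   | b , mb , b≠0 , b≠y = off-m , my , b , valid , join≐plane off-m my mb valid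
        where
        valid = pair-valid off-m my mb y≠0 b≠0 b≠y
    lifted : Sg y₀ ≡ true ⊎ Sg (y₀ ⊕ P) ≡ true → LineThrough y₀
    lifted (inj₁ Sy₀) = through y₀ Sy₀ (∨-introˡ (==-refl y₀)) (proj₁ (∧-elim {offΠᵇ y₀} offs))
    lifted (inj₂ Sy₀P) = through (y₀ ⊕ P) Sy₀P (∨-introʳ {y₀ ⊕ P == y₀} (==-refl (y₀ ⊕ P)))
                           (proj₁ (∧-elim {offΠᵇ (y₀ ⊕ P)} (proj₂ (∧-elim {offΠᵇ y₀} offs))))

  joins-meet-in-P : ∀ {m m′ z} → IsTILineIn Sg m → IsTILineIn Sg m′ → Disjoint m m′ →
                    join P m z ≡ true → join P m′ z ≡ true → z ≡ 0v ⊎ z ≡ P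
  joins-meet-in-P {m} {m′} {z} (_ , _ , m⊆Sg , _) m′-TI disj Jz J′z with ∨-elim {m z} Jz
  ... | inj₁ mz = inj₁ (disj z mz (join∩Sg m′-TI (m⊆Sg z mz) J′z))
  ... | inj₂ mzP = inj₂ (⊕≡0v⇒≡ z P (disj (z ⊕ P) mzP
                     (join∩Sg m′-TI (m⊆Sg (z ⊕ P) mzP) (trans (join-shift P m′ z) J′z))))

  disjoint-from-bad : ∀ {m m′ y b} → IsTILineIn Sg m → IsTILineIn Sg m′ → Disjoint m m′ →
                      join P m ≐ plane P y b → join P m′ ≐ L (symMat (alt P)) →
                      ¬ (∃ λ z → meetsAltᵇ P y b z ≡ true)
  disjoint-from-bad {m} {m′} {y} {b} m-TI m′-TI disj m≐plane m′≐alt (z , meets) =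
    away (meetsAlt-parts {P} {y} {b} {z} meets)
    where
    away : IsPoint z × (z == P) ≡ false × L (symMat (alt P)) z ≡ true × plane P y b z ≡ true → ⊥
    away (z≠0 , z≠P , alt-z , plane-z) = not-0-nor-P
      (joins-meet-in-P {m} {m′} {z} m-TI m′-TI disj (trans (m≐plane z) plane-z) (trans (m′≐alt z) alt-z))
      where
      not-0-nor-P : z ≡ 0v ⊎ z ≡ P → ⊥
      not-0-nor-P (inj₁ z≡0) = isZero-false⇒≢0v z≠0 z≡0
      not-0-nor-P (inj₂ z≡P) = true≢false (subst (λ w → (w == P) ≡ true) (sym z≡P) (==-refl P)) z≠P

  bad-excluded : ¬ Any (λ m → join P m ≐ L (symMat (alt P))) lines
  bad-excluded bad = excluded (same-or-related Disjoint-sym lines-disjoint line (all-any-zip lines-TI bad))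
    where
    sd : Seed P (λ y b → ∃ λ z → meetsAltᵇ P y b z ≡ true)
    sd = bad-seed P≠0 P∈Π₂
    open LineThrough (line-through (Seed.y₀ sd) (Seed.liftable sd))
    y∉alt : L (symMat (alt P)) y ≡ false
    y∉alt = not-true (lift-cases {P} {Seed.y₀ sd} {y} (λ v → not (L (symMat (alt P)) v)) lift-of
              (proj₁ (liftable-off-alt {P} (Seed.liftable sd))) (proj₂ (liftable-off-alt {P} (Seed.liftable sd))))
    Bad : VSet 6 → Set
    Bad m = IsTILineIn Sg m × join P m ≐ L (symMat (alt P))
    excluded : Any (λ m → ThroughLine y m × Bad m) lines
               ⊎ (∃₂ λ m m′ → ThroughLine y m × Bad m′ × Disjoint m m′) → ⊥
    excluded (inj₁ same) = through-bad (proj₂ (Any.satisfied same))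
      where
      through-bad : ∀ {m} → ThroughLine y m × Bad m → ⊥
      through-bad {m} ((_ , my , _) , (_ , m≐alt)) = true≢false (trans (sym (m≐alt y)) (∨-introˡ {m y} my)) y∉alt
    excluded (inj₂ (m , m′ , ((m-TI , _) , _ , b , valid , m≐plane) , (m′-TI , m′≐alt) , disj)) =
      disjoint-from-bad m-TI m′-TI disj m≐plane m′≐alt (Seed.good sd y b lift-of valid)

  inCode-of-line : ∀ s →
    Any (λ ℓ → ¬ ℓ ≐ (Sg ∩ Π₁) × ¬ ℓ ≐ (Sg ∩ Π₂) × L (symMat s) ≐ join P ℓ) lines → inCode s ≡ true
  inCode-of-line s in-X = from-line (Any.satisfied (all-any-zip classified in-X))
    where
    s≢alt : s ≢ alt P
    s≢alt s≡alt = bad-excluded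
      (Any.map (λ (_ , _ , L≐) v → trans (sym (L≐ v)) (cong (λ t → L (symMat t) v) s≡alt)) in-X)
    from-line : (∃ λ ℓ → Classified ℓ × ¬ ℓ ≐ (Sg ∩ Π₁) × ¬ ℓ ≐ (Sg ∩ Π₂) × L (symMat s) ≐ join P ℓ) →
                inCode s ≡ true
    from-line (ℓ , cl , ℓ≠r , ℓ≠t , L≐) =
      inCode-of-trace s P≠0 P∈Π₂ (trans (L≐ P) (join-base P ℓ ℓ0)) s≢alt
      (λ v Lv Π₂v → join-Π₂ (off-line cl ℓ≠r ℓ≠t) v (trans (sym (L≐ v)) Lv) Π₂v)
      where
      ℓ0 : ℓ 0v ≡ true
      ℓ0 = proj₁ (TI-subspace (proj₁ cl))

-- The code does not depend on the choices

codeword-in-X : (c : Choice) → ∀ s → inCode s ≡ true → isZero s ≡ false → InX c (L (symMat s))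
codeword-in-X c s cs s≠0 = at-kernel (codeword-seed s cs s≠0)
  where
  P = kernelPoint s
  at-kernel : IsPoint P × Π₂ P ≡ true × Seed P (λ y b → L (symMat s) ≐ plane P y b) → InX c (L (symMat s))
  at-kernel (P≠0 , P∈Π₂ , sd) = inj₂ (P , P≠0 , P∈Π₂ , Any.map found line)
    where
    open AtPoint c {P} P≠0 P∈Π₂
    open LineThrough (line-through (Seed.y₀ sd) (Seed.liftable sd))
    found : ∀ {m} → ThroughLine y m → ¬ m ≐ (Sg ∩ Π₁) × ¬ m ≐ (Sg ∩ Π₂) × L (symMat s) ≐ join P m
    found {m} (off , my , b , valid , m≐plane) =
      ≐-outside my (disjoint-point (proj₁ (proj₂ off)) my y≠0) ,
      ≐-outside my (disjoint-point (proj₂ (proj₂ off)) my y≠0) ,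
      λ v → trans (Seed.good sd y b lift-of valid v) (sym (m≐plane v))

inCode-of-InC : (c : Choice) (S : Mat3) → InC c S → inCode (upper S) ≡ true
inCode-of-InC c S (S-sym , S∈X) = from-X (subst (λ M → InX c (L M)) (sym (symMat-upper S S-sym)) S∈X)
  where
  from-X : InX c (L (symMat (upper S))) → inCode (upper S) ≡ true
  from-X (inj₁ L≐Π₂) = subst (λ s → inCode s ≡ true) (sym (L-determined (upper S) 0v L≐Π₂)) refl
  from-X (inj₂ (P , P≠0 , P∈Π₂ , in-X)) = AtPoint.inCode-of-line c {P} P≠0 P∈Π₂ (upper S) in-X

InC-of-inCode : (c : Choice) (S : Mat3) → IsSym S → inCode (upper S) ≡ true → InC c S
InC-of-inCode c S S-sym cs = S-sym , subst (λ M → InX c (L M)) (symMat-upper S S-sym) (to-X (isZero (upper S)) refl)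
  where
  to-X : ∀ z → isZero (upper S) ≡ z → InX c (L (symMat (upper S)))
  to-X true S≡0 = inj₁ (λ v → cong (λ s → L (symMat s) v) (isZero⇒≡0v {v = upper S} S≡0))
  to-X false S≠0 = codeword-in-X c (upper S) cs S≠0

mainTheorem10 : (c : Choice) →
    (∀ S S′ → InC c S → InC c S′ → S ≢ S′ → 2 ≤ rk (S ⊟ S′))
    × (∀ S′ → IsSym S′ → ¬ InC c S′ → ¬ (∀ S → InC c S → 2 ≤ rk (S′ ⊟ S)))
mainTheorem10 c = distance , maximality
  where
  distance : ∀ S S′ → InC c S → InC c S′ → S ≢ S′ → 2 ≤ rk (S ⊟ S′)
  distance S S′ S∈C S′∈C S≢S′ =
    subst₂ (λ A B → 2 ≤ rk (A ⊟ B)) (symMat-upper S (proj₁ S∈C)) (symMat-upper S′ (proj₁ S′∈C))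
      (code-distance (upper S) (upper S′) (inCode-of-InC c S S∈C) (inCode-of-InC c S′ S′∈C)
        (λ s≡s′ → S≢S′ (trans (sym (symMat-upper S (proj₁ S∈C)))
                         (trans (cong symMat s≡s′) (symMat-upper S′ (proj₁ S′∈C))))))
  maximality : ∀ S′ → IsSym S′ → ¬ InC c S′ → ¬ (∀ S → InC c S → 2 ≤ rk (S′ ⊟ S))
  maximality S′ S′-sym S′∉C far = outside (inCode (upper S′)) refl
    where
    outside : ∀ b → inCode (upper S′) ≡ b → ⊥
    outside true cs = S′∉C (InC-of-inCode c S′ S′-sym cs)
    outside false cs = near-codeword (code-maximal (upper S′) cs)
      where
      near-codeword : (∃ λ s → inCode s ≡ true × ¬ (2 ≤ rk (symMat (upper S′) ⊟ symMat s))) → ⊥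
      near-codeword (s , s∈C , near) = near (subst (λ A → 2 ≤ rk (A ⊟ symMat s)) (sym (symMat-upper S′ S′-sym))
        (far (symMat s) (InC-of-inCode c (symMat s) (symMat-isSym s)
          (subst (λ t → inCode t ≡ true) (sym (upper-symMat s)) s∈C))))
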